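{- Let $n\ge 7$ and let $\chi:E(K_n)\to\mathbb{Z}_3$ be a coloring containing an alternating $4$-cycle but no two vertex-disjoint alternating $4$-cycles, such that for every alternating $4$-cycle $C$ the coloring restricted to $K_n-V(C)$ is monochromatic. Writing $\mathbb{Z}_3=\{a,b,c\}$ with $a,b,c$ distinct, $\chi$ has (up to renaming colors) one of the following forms: (1) there is a monochromatic clique on $n-1$ vertices and the edges at the remaining vertex do not all have the same color; (2) there is a monochromatic clique $Q$ on $n-2$ vertices of color $a$, and for each of the two vertices $u,v\notin Q$ all edges from it to $Q$ have the same color, with one of the subpatterns: (a) all edges not inside $Q$ have color $b$; (b) all edges not inside $Q$ have color $b$ except $uv$, which has color $a$; (c) all edges incident to $u$ have color $b$ and all edges incident to $v$ other than $uv$ have color $c$; (3) there is a triangle $xyz$ such that all edges of $K_n$ not in $\{xy,yz,xz\}$ have the same color.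
   Context: A $4$-cycle is alternating if the sums of the colors on its two perfect matchings are distinct. -}

module Defs where

open import Data.Nat using (ℕ; _+_; _%_)
open import Data.Fin using (Fin; toℕ)
open import Data.Product using (Σ; _×_; ∃)
open import Data.Sum using (_⊎_)
open import Relation.Binary.PropositionalEquality using (_≡_; _≢_)
open import Relation.Nullary using (¬_)

Colour : Set
Colour = Fin 3

_+₃_ : Colour → Colour → ℕ
a +₃ b = (toℕ a + toℕ b) % 3

-- An edge colouring of K_n: vertices Fin n, edge {x,y} (x ≢ y) gets χ x y.
-- Values on the diagonal are irrelevant; symmetry is a hypothesis.
Colouring : ℕ → Set
Colouring n = Fin n → Fin n → Colour

Symmetric : ∀ {n} → Colouring n → Set
Symmetric χ = ∀ x y → χ x y ≡ χ y x

record FourCycle (n : ℕ) : Set where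
  constructor cyc
  field
    w x y z : Fin n
    w≢x : w ≢ x
    w≢y : w ≢ y
    w≢z : w ≢ z
    x≢y : x ≢ y
    x≢z : x ≢ z
    y≢z : y ≢ z

open FourCycle public

_∈C_ : ∀ {n} → Fin n → FourCycle n → Set
v ∈C C = v ≡ w C ⊎ v ≡ x C ⊎ v ≡ y C ⊎ v ≡ z C

-- perfect matchings {wx,yz} and {xy,zw}; alternating iff colour sums differ in ℤ₃
Alternating : ∀ {n} → Colouring n → FourCycle n → Set
Alternating χ C = (χ (w C) (x C) +₃ χ (y C) (z C)) ≢ (χ (x C) (y C) +₃ χ (z C) (w C))

VertexDisjoint : ∀ {n} → FourCycle n → FourCycle n → Set
VertexDisjoint C D = ∀ v → v ∈C C → ¬ (v ∈C D)

MonoOutside : ∀ {n} → Colouring n → FourCycle n → Set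
MonoOutside χ C = ∃ λ a → ∀ p q → ¬ (p ∈C C) → ¬ (q ∈C C) → p ≢ q → χ p q ≡ a

Form1 : ∀ {n} → Colouring n → Set
Form1 {n} χ = Σ (Fin n) λ r → Σ Colour λ a →
  (∀ p q → p ≢ r → q ≢ r → p ≢ q → χ p q ≡ a) ×
  Σ (Fin n) λ s → Σ (Fin n) λ t → s ≢ r × t ≢ r × χ r s ≢ χ r t

InQ : ∀ {n} → Fin n → Fin n → Fin n → Set
InQ u v p = p ≢ u × p ≢ v

Form2 : ∀ {n} → Colouring n → Set
Form2 {n} χ = Σ (Fin n) λ u → Σ (Fin n) λ v → Σ Colour λ a → Σ Colour λ b → Σ Colour λ c →
  u ≢ v × a ≢ b × a ≢ c × b ≢ c ×
  (∀ p q → InQ u v p → InQ u v q → p ≢ q → χ p q ≡ a) ×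
  (∀ p q → InQ u v p → InQ u v q → χ u p ≡ χ u q) ×
  (∀ p q → InQ u v p → InQ u v q → χ v p ≡ χ v q) ×
  (
    ((∀ p → InQ u v p → χ u p ≡ b × χ v p ≡ b) × χ u v ≡ b)
  ⊎
    ((∀ p → InQ u v p → χ u p ≡ b × χ v p ≡ b) × χ u v ≡ a)
  ⊎
    ((∀ p → InQ u v p → χ u p ≡ b × χ v p ≡ c) × χ u v ≡ b))

InTri : ∀ {n} → Fin n → Fin n → Fin n → Fin n → Fin n → Set
InTri a b c p q = (p ≡ a ⊎ p ≡ b ⊎ p ≡ c) × (q ≡ a ⊎ q ≡ b ⊎ q ≡ c)

Form3 : ∀ {n} → Colouring n → Set
Form3 {n} χ = Σ (Fin n) λ a → Σ (Fin n) λ b → Σ (Fin n) λ c →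
  a ≢ b × a ≢ c × b ≢ c × Σ Colour λ d →
  (∀ p q → p ≢ q → ¬ InTri a b c p q → χ p q ≡ d)

{-# OPTIONS --safe #-}
module Submission where

-- A 4-set is flat when its three perfect matchings have the same colour sum.  It carries an
-- alternating 4-cycle exactly when it is not flat, so the hypothesis says that the complement of
-- every non-flat 4-set is monochromatic.  A vertex seeing two corners of a monochromatic triangle
-- in different colours spans a non-flat 4-set with it; starting from the given alternating 4-cycle
-- and playing such 4-sets against each other shows that all edges avoiding some pair u, v share a
-- colour a.  If u and v see the rest in single colours fu and fv, form (1) or (2) appears unless
-- χ(uv) + a = fu + fv; but then χ(pq) = F(p) + F(q) − a for a potential F on the vertices, every
-- 4-set is flat and no alternating 4-cycle exists.  If u sees the rest in two colours, forcing
-- arguments of the same kind give form (1) or (3).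

open import Defs
open import Data.Nat as ℕ using (ℕ; _<_; _≤_; _+_; _*_; s≤s)
open import Data.Nat.DivMod using (_mod_)
open import Data.Nat.Properties using (<-irrefl; ≤-trans; +-comm)
open import Data.Fin using (Fin; toℕ)
open import Data.Fin.Properties using (_≟_; all?; any?; ¬∀⟶∃¬; pigeonhole)
open import Data.List using (List; []; _∷_; length; lookup)
open import Data.List.Membership.Propositional using (_∈_)
open import Data.List.Relation.Unary.All using (All; []; _∷_)
open import Data.List.Relation.Unary.All.Properties using (¬Any⇒All¬)
open import Data.List.Relation.Unary.Any as Any using (index)
open import Data.List.Relation.Unary.Any.Properties using (lookup-index)
open import Data.Product using (Σ; ∃; ∃₂; _×_; _,_; proj₁; proj₂; swap)
open import Data.Sum using (_⊎_; inj₁; inj₂; [_,_]′)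
open import Data.Empty using (⊥; ⊥-elim)
open import Relation.Nullary using (¬_; ¬?; Dec; yes; no)
open import Relation.Nullary.Decidable using (True; toWitness; from-yes; _→-dec_; _×-dec_; decidable-stable)
open import Relation.Unary using (Decidable)
open import Relation.Binary.PropositionalEquality using (_≡_; _≢_; refl; sym; trans; cong; cong₂; ≢-sym)
open import Function using (_∘_)

-- Arithmetic in ℤ₃

+₃-comm : ∀ a b → a +₃ b ≡ b +₃ a
+₃-comm a b = cong (ℕ._% 3) (+-comm (toℕ a) (toℕ b))

+₃-cancelʳ : ∀ a b k → a +₃ k ≡ b +₃ k → a ≡ b
+₃-cancelʳ = from-yes (all? λ a → all? λ b → all? λ k → (a +₃ k ℕ.≟ b +₃ k) →-dec (a ≟ b))

-- b₁ + b₂ − k, written with −k = 2k.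
potential : Colour → Colour → Colour → Colour
potential b₁ b₂ k = (toℕ b₁ + toℕ b₂ + 2 * toℕ k) mod 3

potential-unique : ∀ c k b₁ b₂ → c +₃ k ≡ b₁ +₃ b₂ → c ≡ potential b₁ b₂ k
potential-unique = from-yes (all? λ c → all? λ k → all? λ b₁ → all? λ b₂ →
  (c +₃ k ℕ.≟ b₁ +₃ b₂) →-dec (c ≟ potential b₁ b₂ k))

potential-comm : ∀ b₁ b₂ k → potential b₁ b₂ k ≡ potential b₂ b₁ k
potential-comm b₁ b₂ k = cong (λ m → (m + 2 * toℕ k) mod 3) (+-comm (toℕ b₁) (toℕ b₂))

potential-idʳ : ∀ b k → potential b k k ≡ b
potential-idʳ = from-yes (all? λ b → all? λ k → potential b k k ≟ b)

potential-matchings : ∀ A B C D k →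
  potential A B k +₃ potential C D k ≡ potential A C k +₃ potential B D k ×
  potential A B k +₃ potential C D k ≡ potential A D k +₃ potential B C k
potential-matchings = from-yes (all? λ A → all? λ B → all? λ C → all? λ D → all? λ k →
  (potential A B k +₃ potential C D k ℕ.≟ potential A C k +₃ potential B D k) ×-dec
  (potential A B k +₃ potential C D k ℕ.≟ potential A D k +₃ potential B C k))

distinct-sum : (a b c : Colour) → a ≢ b → a ≢ c → b ≢ c → a +₃ b ≡ c +₃ c
distinct-sum = from-yes (all? λ a → all? λ b → all? λ c →
  ¬? (a ≟ b) →-dec ¬? (a ≟ c) →-dec ¬? (b ≟ c) →-dec (a +₃ b ℕ.≟ c +₃ c))

only-three-colours : (a b c d : Colour) → a ≢ b → a ≢ c → b ≢ c → d ≢ b → d ≢ c → d ≡ a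
only-three-colours = from-yes (all? λ (a : Colour) → all? λ b → all? λ c → all? λ d →
  ¬? (a ≟ b) →-dec ¬? (a ≟ c) →-dec ¬? (b ≟ c) →-dec ¬? (d ≟ b) →-dec ¬? (d ≟ c) →-dec (d ≟ a))

third-colour : (a b : Colour) → a ≢ b → ∃ λ c → a ≢ c × b ≢ c
third-colour = from-yes (all? λ (a : Colour) → all? λ b → ¬? (a ≟ b) →-dec
  any? λ c → ¬? (a ≟ c) ×-dec ¬? (b ≟ c))

list-misses-some-vertex : ∀ {n} (xs : List (Fin n)) → length xs < n → ¬ (∀ v → v ∈ xs)
list-misses-some-vertex xs |xs|<n v∈xs
  with i , j , i<j , same-index ← pigeonhole |xs|<n (index ∘ v∈xs) =
  <-irrefl (cong toℕ i≡j) i<j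
  where
  i≡j : i ≡ j
  i≡j = trans (lookup-index (v∈xs i)) (trans (cong (lookup xs) same-index) (sym (lookup-index (v∈xs j))))

fresh : ∀ {n} (xs : List (Fin n)) → length xs < n → ∃ λ v → All (v ≢_) xs
fresh {n} xs |xs|<n with v , v∉xs ← ¬∀⟶∃¬ n (_∈ xs) (λ v → Any.any? (v ≟_) xs) (list-misses-some-vertex xs |xs|<n) =
  v , ¬Any⇒All¬ xs v∉xs

Distinct4 : ∀ {n} → Fin n → Fin n → Fin n → Fin n → Set
Distinct4 w x y z = w ≢ x × w ≢ y × w ≢ z × x ≢ y × x ≢ z × y ≢ z

Outside : ∀ {n} → Fin n → Fin n → Fin n → Fin n → Fin n → Set
Outside w x y z p = p ≢ w × p ≢ x × p ≢ y × p ≢ z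

outside? : ∀ {n} (w x y z : Fin n) → Decidable (Outside w x y z)
outside? w x y z p = ¬? (p ≟ w) ×-dec ¬? (p ≟ x) ×-dec ¬? (p ≟ y) ×-dec ¬? (p ≟ z)

InQ? : ∀ {n} (u v : Fin n) → Decidable (InQ u v)
InQ? u v p = ¬? (p ≟ u) ×-dec ¬? (p ≟ v)

module _ {n : ℕ} {w x y z : Fin n} where

  Distinct4-swap₁₂ : Distinct4 w x y z → Distinct4 x w y z
  Distinct4-swap₁₂ (w≢x , w≢y , w≢z , x≢y , x≢z , y≢z) = ≢-sym w≢x , x≢y , x≢z , w≢y , w≢z , y≢z

  Distinct4-swap₂₃ : Distinct4 w x y z → Distinct4 w y x z
  Distinct4-swap₂₃ (w≢x , w≢y , w≢z , x≢y , x≢z , y≢z) = w≢y , w≢x , w≢z , ≢-sym x≢y , y≢z , x≢z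

  Distinct4-swap₃₄ : Distinct4 w x y z → Distinct4 w x z y
  Distinct4-swap₃₄ (w≢x , w≢y , w≢z , x≢y , x≢z , y≢z) = w≢x , w≢z , w≢y , x≢z , x≢y , ≢-sym y≢z

  Outside-swap₁₂ : ∀ {p} → Outside w x y z p → Outside x w y z p
  Outside-swap₁₂ (p≢w , p≢x , p≢y , p≢z) = p≢x , p≢w , p≢y , p≢z

  Outside-swap₂₃ : ∀ {p} → Outside w x y z p → Outside w y x z p
  Outside-swap₂₃ (p≢w , p≢x , p≢y , p≢z) = p≢w , p≢y , p≢x , p≢z

  Outside-swap₃₄ : ∀ {p} → Outside w x y z p → Outside w x z y p
  Outside-swap₃₄ (p≢w , p≢x , p≢y , p≢z) = p≢w , p≢x , p≢z , p≢y

module _ {n : ℕ} (χ : Colouring n) (χ-sym : Symmetric χ) where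

  MonoOn : (Fin n → Set) → Colour → Set
  MonoOn P c = ∀ p q → P p → P q → p ≢ q → χ p q ≡ c

  MonoStar : Fin n → (Fin n → Set) → Colour → Set
  MonoStar x P c = ∀ p → P p → χ x p ≡ c

  UniformOn : Fin n → (Fin n → Set) → Set
  UniformOn x P = ∀ p q → P p → P q → χ x p ≡ χ x q

  Splits : Fin n → (Fin n → Set) → Set
  Splits x P = ∃₂ λ r s → P r × P s × χ x r ≢ χ x s

  MonoOn-⊆ : ∀ {P Q : Fin n → Set} {c} → (∀ {p} → Q p → P p) → MonoOn P c → MonoOn Q c
  MonoOn-⊆ Q⊆P mono p q Qp Qq = mono p q (Q⊆P Qp) (Q⊆P Qq)

  UniformOn-⊆ : ∀ {P Q : Fin n → Set} {x} → (∀ {p} → Q p → P p) → UniformOn x P → UniformOn x Q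
  UniformOn-⊆ Q⊆P uniform p q Qp Qq = uniform p q (Q⊆P Qp) (Q⊆P Qq)

  Splits-⊆ : ∀ {P Q : Fin n → Set} {x} → (∀ {p} → P p → Q p) → Splits x P → Splits x Q
  Splits-⊆ P⊆Q (r , s , Pr , Ps , split) = r , s , P⊆Q Pr , P⊆Q Ps , split

  UniformOn⇒MonoStar : ∀ {x P p₀} → UniformOn x P → P p₀ → MonoStar x P (χ x p₀)
  UniformOn⇒MonoStar uniform Pp₀ p Pp = uniform p _ Pp Pp₀

  MonoStar⇒UniformOn : ∀ {x P c} → MonoStar x P c → UniformOn x P
  MonoStar⇒UniformOn star p q Pp Pq = trans (star p Pp) (sym (star q Pq))

  uniform-or-split : ∀ {P} → Decidable P → ∀ x → UniformOn x P ⊎ Splits x P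
  uniform-or-split P? x with any? (λ r → any? λ s → P? r ×-dec P? s ×-dec ¬? (χ x r ≟ χ x s))
  ... | yes (r , s , Pr , Ps , split) = inj₂ (r , s , Pr , Ps , split)
  ... | no no-split = inj₁ λ r s Pr Ps →
    decidable-stable (χ x r ≟ χ x s) λ split → no-split (r , s , Pr , Ps , split)

  star-or-exception : ∀ {P} → Decidable P → ∀ x c → MonoStar x P c ⊎ ∃ λ t → P t × χ x t ≢ c
  star-or-exception P? x c with any? (λ t → P? t ×-dec ¬? (χ x t ≟ c))
  ... | yes (t , Pt , χxt≢c) = inj₂ (t , Pt , χxt≢c)
  ... | no no-exception = inj₁ λ t Pt →
    decidable-stable (χ x t ≟ c) λ χxt≢c → no-exception (t , Pt , χxt≢c)

  MonoOn-insert : ∀ {P c} q → MonoOn P c → MonoStar q P c → MonoOn (λ p → p ≡ q ⊎ P p) c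
  MonoOn-insert q mono star p .p (inj₁ refl) (inj₁ refl) p≢p = ⊥-elim (p≢p refl)
  MonoOn-insert q mono star p r (inj₁ refl) (inj₂ Pr) _ = star r Pr
  MonoOn-insert q mono star p r (inj₂ Pp) (inj₁ refl) _ = trans (χ-sym p q) (star p Pp)
  MonoOn-insert q mono star p r (inj₂ Pp) (inj₂ Pr) p≢r = mono p r Pp Pr p≢r

  MonoOn-extend₁ : ∀ {u v c} → MonoOn (InQ u v) c → MonoStar v (InQ u v) c → MonoOn (_≢ u) c
  MonoOn-extend₁ {u} {v} mono star = MonoOn-⊆ cover (MonoOn-insert v mono star)
    where
    cover : ∀ {p} → p ≢ u → p ≡ v ⊎ InQ u v p
    cover {p} p≢u with p ≟ v
    ... | yes p≡v = inj₁ p≡v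
    ... | no p≢v = inj₂ (p≢u , p≢v)

  MonoOn-extend₂ : ∀ {u v x y c} → MonoOn (Outside u v x y) c →
    MonoStar x (Outside u v x y) c → MonoStar y (Outside u v x y) c → χ x y ≡ c → MonoOn (InQ u v) c
  MonoOn-extend₂ {u} {v} {x} {y} {c} mono star-x star-y xy≡c =
    MonoOn-⊆ cover (MonoOn-insert x (MonoOn-insert y mono star-y) star-x′)
    where
    star-x′ : MonoStar x (λ p → p ≡ y ⊎ Outside u v x y p) c
    star-x′ _ (inj₁ refl) = xy≡c
    star-x′ p (inj₂ p-out) = star-x p p-out
    cover : ∀ {p} → InQ u v p → p ≡ x ⊎ p ≡ y ⊎ Outside u v x y p
    cover {p} (p≢u , p≢v) with p ≟ x | p ≟ y
    ... | yes p≡x | _ = inj₁ p≡x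
    ... | no _ | yes p≡y = inj₂ (inj₁ p≡y)
    ... | no p≢x | no p≢y = inj₂ (inj₂ (p≢u , p≢v , p≢x , p≢y))

  AllButTwoMono : Set
  AllButTwoMono = ∃₂ λ u v → u ≢ v × ∃ (MonoOn (InQ u v))

  -- Flat 4-sets

  Flat : Fin n → Fin n → Fin n → Fin n → Set
  Flat w x y z = (χ w x +₃ χ y z ≡ χ w y +₃ χ x z) × (χ w x +₃ χ y z ≡ χ w z +₃ χ x y)

  flat? : ∀ w x y z → Dec (Flat w x y z)
  flat? w x y z = (χ w x +₃ χ y z ℕ.≟ χ w y +₃ χ x z) ×-dec (χ w x +₃ χ y z ℕ.≟ χ w z +₃ χ x y)

  module _ {w x y z : Fin n} where

    Flat-swap₁₂ : Flat w x y z → Flat x w y z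
    Flat-swap₁₂ (e₂ , e₃) = trans wx≡xw-sum (trans e₃ (+₃-comm (χ w z) (χ x y))) ,
                            trans wx≡xw-sum (trans e₂ (+₃-comm (χ w y) (χ x z)))
      where
      wx≡xw-sum : χ x w +₃ χ y z ≡ χ w x +₃ χ y z
      wx≡xw-sum = cong (_+₃ χ y z) (χ-sym x w)

    Flat-swap₂₃ : Flat w x y z → Flat w y x z
    Flat-swap₂₃ (e₂ , e₃) = sym e₂ , trans (sym e₂) (trans e₃ (cong (χ w z +₃_) (χ-sym x y)))

    Flat-swap₃₄ : Flat w x y z → Flat w x z y
    Flat-swap₃₄ (e₂ , e₃) = trans zy≡yz-sum e₃ , trans zy≡yz-sum e₂
      where
      zy≡yz-sum : χ w x +₃ χ z y ≡ χ w x +₃ χ y z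
      zy≡yz-sum = cong (χ w x +₃_) (χ-sym z y)

    flat-of-sums : ∀ k → χ w x +₃ χ y z ≡ k → χ w y +₃ χ x z ≡ k → χ w z +₃ χ x y ≡ k → Flat w x y z
    flat-of-sums k e₁ e₂ e₃ = trans e₁ (sym e₂) , trans e₁ (sym e₃)

    flat-over-triangle : ∀ {c} → χ x y ≡ c → χ x z ≡ c → χ y z ≡ c →
      Flat w x y z → χ w x ≡ χ w y × χ w x ≡ χ w z
    flat-over-triangle {c} xy xz yz (e₂ , e₃) =
      +₃-cancelʳ _ _ c (trans (cong (χ w x +₃_) (sym yz)) (trans e₂ (cong (χ w y +₃_) xz))) ,
      +₃-cancelʳ _ _ c (trans (cong (χ w x +₃_) (sym yz)) (trans e₃ (cong (χ w z +₃_) xy)))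

    ¬flat-of-split : χ x y ≡ χ x z → χ w y ≢ χ w z → ¬ Flat w x y z
    ¬flat-of-split xy≡xz split (e₂ , e₃) = split (+₃-cancelʳ (χ w y) (χ w z) (χ x z)
      (trans (sym e₂) (trans e₃ (cong (χ w z +₃_) xy≡xz))))

    flat-cross : ∀ {c d} → Flat w x y z → χ w x ≡ c → χ y z ≡ d → χ w z ≡ c → χ x z ≡ c →
      χ w y ≡ d × χ x y ≡ d
    flat-cross {c} {d} (e₂ , e₃) wx≡c yz≡d wz≡c xz≡c =
      +₃-cancelʳ (χ w y) d c (trans (cong (χ w y +₃_) (sym xz≡c)) (trans (sym e₂) (trans cd≡ (+₃-comm c d)))) ,
      +₃-cancelʳ (χ x y) d c (trans (+₃-comm (χ x y) c)
        (trans (cong (_+₃ χ x y) (sym wz≡c)) (trans (sym e₃) (trans cd≡ (+₃-comm c d)))))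
      where
      cd≡ : χ w x +₃ χ y z ≡ c +₃ d
      cd≡ = cong₂ _+₃_ wx≡c yz≡d

    flat-of-potential : ∀ {fw fx fy fz} k →
      χ w x ≡ potential fw fx k → χ w y ≡ potential fw fy k → χ w z ≡ potential fw fz k →
      χ x y ≡ potential fx fy k → χ x z ≡ potential fx fz k → χ y z ≡ potential fy fz k →
      Flat w x y z
    flat-of-potential {fw} {fx} {fy} {fz} k wx wy wz xy xz yz =
      let (m₁≡m₂ , m₁≡m₃) = potential-matchings fw fx fy fz k
      in trans (cong₂ _+₃_ wx yz) (trans m₁≡m₂ (sym (cong₂ _+₃_ wy xz))) ,
         trans (cong₂ _+₃_ wx yz) (trans m₁≡m₃ (sym (cong₂ _+₃_ wz xy)))

  alternating⇒¬flat : ∀ C → Alternating χ C → ¬ Flat (w C) (x C) (y C) (z C)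
  alternating⇒¬flat (cyc w x y z _ _ _ _ _ _) alternating (_ , e₃) =
    alternating (trans e₃ (trans (+₃-comm (χ w z) (χ x y)) (cong (χ x y +₃_) (χ-sym w z))))

  potential⇒¬alternating : ∀ (F : Fin n → Colour) k → (∀ p q → p ≢ q → χ p q ≡ potential (F p) (F q) k) →
    ∀ C → ¬ Alternating χ C
  potential⇒¬alternating F k potential-form C@(cyc w x y z w≢x w≢y w≢z x≢y x≢z y≢z) alternating =
    alternating⇒¬flat C alternating (flat-of-potential {fw = F w} {F x} {F y} {F z} k
      (potential-form w x w≢x) (potential-form w y w≢y) (potential-form w z w≢z)
      (potential-form x y x≢y) (potential-form x z x≢z) (potential-form y z y≢z))

  record NonFlatQuad (w x y z : Fin n) : Set where
    field
      distinct : Distinct4 w x y z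
      nonflat  : ¬ Flat w x y z
      colour   : Colour
      mono     : MonoOn (Outside w x y z) colour

  module _ {w x y z : Fin n} (Q : NonFlatQuad w x y z) where
    open NonFlatQuad Q

    NonFlatQuad-swap₁₂ : NonFlatQuad x w y z
    NonFlatQuad-swap₁₂ = record
      { distinct = Distinct4-swap₁₂ distinct ; nonflat = nonflat ∘ Flat-swap₁₂
      ; colour = colour ; mono = MonoOn-⊆ Outside-swap₁₂ mono }

    NonFlatQuad-swap₂₃ : NonFlatQuad w y x z
    NonFlatQuad-swap₂₃ = record
      { distinct = Distinct4-swap₂₃ distinct ; nonflat = nonflat ∘ Flat-swap₂₃
      ; colour = colour ; mono = MonoOn-⊆ Outside-swap₂₃ mono }

    NonFlatQuad-swap₃₄ : NonFlatQuad w x z y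
    NonFlatQuad-swap₃₄ = record
      { distinct = Distinct4-swap₃₄ distinct ; nonflat = nonflat ∘ Flat-swap₃₄
      ; colour = colour ; mono = MonoOn-⊆ Outside-swap₃₄ mono }

  record UniformQuad (w x y z : Fin n) : Set where
    field
      quad     : NonFlatQuad w x y z
      r₀       : Fin n
      r₀-out   : Outside w x y z r₀
      uniform₁ : UniformOn w (Outside w x y z)
      uniform₂ : UniformOn x (Outside w x y z)
      uniform₃ : UniformOn y (Outside w x y z)
      uniform₄ : UniformOn z (Outside w x y z)

    open NonFlatQuad quad public

    f : Fin n → Colour
    f k = χ k r₀

  module _ {w x y z : Fin n} (U : UniformQuad w x y z) where
    open UniformQuad U

    UniformQuad-swap₁₂ : UniformQuad x w y z
    UniformQuad-swap₁₂ = record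
      { quad = NonFlatQuad-swap₁₂ quad ; r₀ = r₀ ; r₀-out = Outside-swap₁₂ r₀-out
      ; uniform₁ = UniformOn-⊆ Outside-swap₁₂ uniform₂ ; uniform₂ = UniformOn-⊆ Outside-swap₁₂ uniform₁
      ; uniform₃ = UniformOn-⊆ Outside-swap₁₂ uniform₃ ; uniform₄ = UniformOn-⊆ Outside-swap₁₂ uniform₄ }

    UniformQuad-swap₂₃ : UniformQuad w y x z
    UniformQuad-swap₂₃ = record
      { quad = NonFlatQuad-swap₂₃ quad ; r₀ = r₀ ; r₀-out = Outside-swap₂₃ r₀-out
      ; uniform₁ = UniformOn-⊆ Outside-swap₂₃ uniform₁ ; uniform₂ = UniformOn-⊆ Outside-swap₂₃ uniform₃
      ; uniform₃ = UniformOn-⊆ Outside-swap₂₃ uniform₂ ; uniform₄ = UniformOn-⊆ Outside-swap₂₃ uniform₄ }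

    UniformQuad-swap₃₄ : UniformQuad w x z y
    UniformQuad-swap₃₄ = record
      { quad = NonFlatQuad-swap₃₄ quad ; r₀ = r₀ ; r₀-out = Outside-swap₃₄ r₀-out
      ; uniform₁ = UniformOn-⊆ Outside-swap₃₄ uniform₁ ; uniform₂ = UniformOn-⊆ Outside-swap₃₄ uniform₂
      ; uniform₃ = UniformOn-⊆ Outside-swap₃₄ uniform₄ ; uniform₄ = UniformOn-⊆ Outside-swap₃₄ uniform₃ }

  UniformQuad-flip : ∀ {w x y z} → UniformQuad w x y z → UniformQuad y z w x
  UniformQuad-flip = UniformQuad-swap₂₃ ∘ UniformQuad-swap₁₂ ∘ UniformQuad-swap₃₄ ∘ UniformQuad-swap₂₃

  star-of : ∀ {w x y z} (U : UniformQuad w x y z) {k c} → UniformOn k (Outside w x y z) →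
    UniformQuad.f U k ≡ c → MonoStar k (Outside w x y z) c
  star-of U uniform fk≡c r r-out = trans (uniform r (UniformQuad.r₀ U) r-out (UniformQuad.r₀-out U)) fk≡c

  module _ (n≥7 : 7 ≤ n) (alternating⇒mono : ∀ C → Alternating χ C → MonoOutside χ C) where

    pick : (xs : List (Fin n)) {_ : True (length xs ℕ.≤? 6)} → ∃ λ v → All (v ≢_) xs
    pick xs {short} = fresh xs (≤-trans (s≤s (toWitness short)) n≥7)

    pick-outside : ∀ w x y z u v → ∃ λ r → Outside w x y z r × r ≢ u × r ≢ v
    pick-outside w x y z u v with r , r≢w ∷ r≢x ∷ r≢y ∷ r≢z ∷ r≢u ∷ r≢v ∷ [] ← pick (w ∷ x ∷ y ∷ z ∷ u ∷ v ∷ []) =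
      r , (r≢w , r≢x , r≢y , r≢z) , r≢u , r≢v

    outside-vertex : ∀ w x y z → ∃ (Outside w x y z)
    outside-vertex w x y z with r , r≢w ∷ r≢x ∷ r≢y ∷ r≢z ∷ [] ← pick (w ∷ x ∷ y ∷ z ∷ []) =
      r , r≢w , r≢x , r≢y , r≢z

    mono-outside-of-cycle : ∀ {P} C → Alternating χ C → (∀ {p} → P p → ¬ p ∈C C) → ∃ (MonoOn P)
    mono-outside-of-cycle C alternating P∉C with c , mono ← alternating⇒mono C alternating =
      c , λ p q Pp Pq → mono p q (P∉C Pp) (P∉C Pq)

    mono-outside : ∀ {w x y z} → Distinct4 w x y z → ¬ Flat w x y z → ∃ (MonoOn (Outside w x y z))
    -- The 4-cycle w x y z compares the matchings {wx, yz} and {xy, zw}; when these agree,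
    -- non-flatness makes the 4-cycle w x z y, comparing {wx, zy} and {xz, yw}, alternating.
    mono-outside {w} {x} {y} {z} (w≢x , w≢y , w≢z , x≢y , x≢z , y≢z) ¬flat
      with (χ w x +₃ χ y z) ℕ.≟ (χ w z +₃ χ x y)
    ... | no e₁≢e₃ = mono-outside-of-cycle (cyc w x y z w≢x w≢y w≢z x≢y x≢z y≢z)
      (λ e → e₁≢e₃ (trans e (trans (cong (χ x y +₃_) (χ-sym z w)) (+₃-comm (χ x y) (χ w z)))))
      λ (p≢w , p≢x , p≢y , p≢z) → [ p≢w , [ p≢x , [ p≢y , p≢z ]′ ]′ ]′
    ... | yes e₁≡e₃ = mono-outside-of-cycle (cyc w x z y w≢x w≢z w≢y x≢z x≢y (≢-sym y≢z))
      (λ e → ¬flat (trans (cong (χ w x +₃_) (χ-sym y z))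
                     (trans e (trans (cong (χ x z +₃_) (χ-sym y w)) (+₃-comm (χ x z) (χ w y)))) , e₁≡e₃))
      λ (p≢w , p≢x , p≢y , p≢z) → [ p≢w , [ p≢x , [ p≢z , p≢y ]′ ]′ ]′

    nonflat-quad : ∀ {w x y z} → Distinct4 w x y z → ¬ Flat w x y z → NonFlatQuad w x y z
    nonflat-quad distinct nonflat with c , mono ← mono-outside distinct nonflat =
      record { distinct = distinct ; nonflat = nonflat ; colour = c ; mono = mono }

    split-triangle-outside : ∀ {x k₁ k₂ k₃ c} → Distinct4 x k₁ k₂ k₃ →
      χ k₁ k₂ ≡ c → χ k₁ k₃ ≡ c → χ k₂ k₃ ≡ c → χ x k₁ ≢ χ x k₂ →
      ∃ (MonoOn (Outside x k₁ k₂ k₃))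
    split-triangle-outside distinct t₁₂ t₁₃ t₂₃ split =
      mono-outside distinct (split ∘ proj₁ ∘ flat-over-triangle t₁₂ t₁₃ t₂₃)

    -- A monochromatic clique on all but two vertices

    module _ {w x y z : Fin n} (Q : NonFlatQuad w x y z) where
      open NonFlatQuad Q

      splitting-vertex⇒monochromatic-rest : Splits w (Outside w x y z) → χ x y ≡ χ y z × χ x z ≡ χ y z
      splitting-vertex⇒monochromatic-rest (r₁ , r₂ , r₁-out , r₂-out , split)
        with (w≢x , w≢y , w≢z , x≢y , x≢z , y≢z) ← distinct
           | (r₁≢w , r₁≢x , r₁≢y , r₁≢z) ← r₁-out
           | (r₂≢w , r₂≢x , r₂≢y , r₂≢z) ← r₂-out
           | r₃ , r₃-out@(r₃≢w , r₃≢x , r₃≢y , r₃≢z) , r₃≢r₁ , r₃≢r₂ ← pick-outside w x y z r₁ r₂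
        with c , mono-c ← split-triangle-outside
               (≢-sym r₁≢w , ≢-sym r₂≢w , ≢-sym r₃≢w , split ∘ cong (χ w) , ≢-sym r₃≢r₁ , ≢-sym r₃≢r₂)
               (mono r₁ r₂ r₁-out r₂-out (split ∘ cong (χ w)))
               (mono r₁ r₃ r₁-out r₃-out (≢-sym r₃≢r₁)) (mono r₂ r₃ r₂-out r₃-out (≢-sym r₃≢r₂)) split
        = trans (mono-c x y x-out y-out x≢y) c≡yz , trans (mono-c x z x-out z-out x≢z) c≡yz
        where
        x-out : Outside w r₁ r₂ r₃ x
        x-out = ≢-sym w≢x , ≢-sym r₁≢x , ≢-sym r₂≢x , ≢-sym r₃≢x
        y-out : Outside w r₁ r₂ r₃ y
        y-out = ≢-sym w≢y , ≢-sym r₁≢y , ≢-sym r₂≢y , ≢-sym r₃≢y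
        z-out : Outside w r₁ r₂ r₃ z
        z-out = ≢-sym w≢z , ≢-sym r₁≢z , ≢-sym r₂≢z , ≢-sym r₃≢z
        c≡yz : c ≡ χ y z
        c≡yz = sym (mono-c y z y-out z-out y≢z)

    three-splitting-vertices-impossible : ∀ {w x y z} → NonFlatQuad w x y z →
      let R = Outside w x y z in Splits w R → Splits x R → Splits y R → ⊥
    three-splitting-vertices-impossible {w} {x} {y} {z} Q w-splits x-splits y-splits =
      NonFlatQuad.nonflat Q (flat-of-sums (χ y z +₃ χ y z)
        (cong (_+₃ χ y z) wx≡yz) (cong₂ _+₃_ wy≡yz xz≡yz) (cong₂ _+₃_ wz≡yz xy≡yz))
      where
      from-w : χ x y ≡ χ y z × χ x z ≡ χ y z
      from-w = splitting-vertex⇒monochromatic-rest Q w-splits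
      from-x : χ w y ≡ χ y z × χ w z ≡ χ y z
      from-x = splitting-vertex⇒monochromatic-rest (NonFlatQuad-swap₁₂ Q) (Splits-⊆ Outside-swap₁₂ x-splits)
      from-y : χ w x ≡ χ x z × χ w z ≡ χ x z
      from-y = splitting-vertex⇒monochromatic-rest (NonFlatQuad-swap₁₂ (NonFlatQuad-swap₂₃ Q))
                 (Splits-⊆ (Outside-swap₁₂ ∘ Outside-swap₂₃) y-splits)
      xy≡yz : χ x y ≡ χ y z
      xy≡yz = proj₁ from-w
      xz≡yz : χ x z ≡ χ y z
      xz≡yz = proj₂ from-w
      wy≡yz : χ w y ≡ χ y z
      wy≡yz = proj₁ from-x
      wz≡yz : χ w z ≡ χ y z
      wz≡yz = proj₂ from-x
      wx≡yz : χ w x ≡ χ y z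
      wx≡yz = trans (proj₁ from-y) xz≡yz

    module SplittingApex {p q₁ q₂ q₃ : Fin n} (Q : NonFlatQuad p q₁ q₂ q₃)
      {r₁ r₂ r₃ : Fin n} (r₁-out : Outside p q₁ q₂ q₃ r₁) (r₂-out : Outside p q₁ q₂ q₃ r₂)
      (r₃-out : Outside p q₁ q₂ q₃ r₃) (r₃≢r₁ : r₃ ≢ r₁) (r₃≢r₂ : r₃ ≢ r₂) (split : χ p r₁ ≢ χ p r₂)
      (uniform₂ : UniformOn q₂ (Outside p q₁ q₂ q₃)) (uniform₃ : UniformOn q₃ (Outside p q₁ q₂ q₃)) where

      open NonFlatQuad Q renaming (colour to a)

      R : Fin n → Set
      R = Outside p q₁ q₂ q₃

      r₁≢r₂ : r₁ ≢ r₂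
      r₁≢r₂ = split ∘ cong (χ p)

      triangle : χ q₁ q₂ ≡ χ q₂ q₃ × χ q₁ q₃ ≡ χ q₂ q₃
      triangle = splitting-vertex⇒monochromatic-rest Q (r₁ , r₂ , r₁-out , r₂-out , split)

      h : Colour
      h = χ q₂ r₁

      star₂ : MonoStar q₂ R h
      star₂ = UniformOn⇒MonoStar uniform₂ r₁-out

      p-mono-off-splitting : ∀ {r s} → R r → R s → s ≢ r → χ q₂ r ≢ χ q₃ r → χ p s ≡ a
      p-mono-off-splitting {r} {s} (r≢p , r≢q₁ , r≢q₂ , r≢q₃) s-out@(s≢p , s≢q₁ , s≢q₂ , s≢q₃) s≢r r-splits
        with (p≢q₁ , p≢q₂ , p≢q₃ , q₁≢q₂ , q₁≢q₃ , q₂≢q₃) ← distinct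
           | t , t-out@(_ , t≢q₁ , t≢q₂ , t≢q₃) , t≢r , t≢s ← pick-outside p q₁ q₂ q₃ r s
        with M , mono-M ← split-triangle-outside (r≢q₂ , r≢q₃ , r≢q₁ , q₂≢q₃ , ≢-sym q₁≢q₂ , ≢-sym q₁≢q₃)
               refl (trans (χ-sym q₂ q₁) (proj₁ triangle)) (trans (χ-sym q₃ q₁) (proj₂ triangle))
               (λ e → r-splits (trans (χ-sym q₂ r) (trans e (χ-sym r q₃))))
        = trans (mono-M p s p-out s-out′ (≢-sym s≢p))
            (trans (sym (mono-M s t s-out′ t-out′ (≢-sym t≢s))) (mono s t s-out t-out (≢-sym t≢s)))
        where
        p-out : Outside r q₂ q₃ q₁ p
        p-out = ≢-sym r≢p , p≢q₂ , p≢q₃ , p≢q₁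
        s-out′ : Outside r q₂ q₃ q₁ s
        s-out′ = s≢r , s≢q₂ , s≢q₃ , s≢q₁
        t-out′ : Outside r q₂ q₃ q₁ t
        t-out′ = t≢r , t≢q₂ , t≢q₃ , t≢q₁

      -- Otherwise both r₁ and r₂ split q₂ q₃, and each forces χ p to be a at the other.
      q₂r₁≡q₃r₁ : χ q₂ r₁ ≡ χ q₃ r₁
      q₂r₁≡q₃r₁ = decidable-stable (χ q₂ r₁ ≟ χ q₃ r₁) λ splits-r₁ →
        split (trans (p-mono-off-splitting r₂-out r₁-out r₁≢r₂ (splits-r₂ splits-r₁))
                     (sym (p-mono-off-splitting r₁-out r₂-out (≢-sym r₁≢r₂) splits-r₁)))
        where
        splits-r₂ : χ q₂ r₁ ≢ χ q₃ r₁ → χ q₂ r₂ ≢ χ q₃ r₂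
        splits-r₂ splits-r₁ e =
          splits-r₁ (trans (uniform₂ r₁ r₂ r₁-out r₂-out) (trans e (uniform₃ r₂ r₁ r₂-out r₁-out)))

      star₃ : MonoStar q₃ R h
      star₃ r r-out = trans (uniform₃ r r₁ r-out r₁-out) (sym q₂r₁≡q₃r₁)

      triangle≡h : χ q₂ q₃ ≡ h
      triangle≡h =
        let (p≢q₁ , p≢q₂ , p≢q₃ , q₁≢q₂ , q₁≢q₃ , q₂≢q₃) = distinct
            (r₁≢p , r₁≢q₁ , r₁≢q₂ , r₁≢q₃) = r₁-out
            (r₂≢p , r₂≢q₁ , r₂≢q₂ , r₂≢q₃) = r₂-out
            (r₃≢p , _ , r₃≢q₂ , r₃≢q₃) = r₃-out
            (M , mono-M) = mono-outside (p≢q₂ , ≢-sym r₁≢p , ≢-sym r₂≢p , ≢-sym r₁≢q₂ , ≢-sym r₂≢q₂ , r₁≢r₂)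
                             (¬flat-of-split (trans (star₂ r₁ r₁-out) (sym (star₂ r₂ r₂-out))) split)
            q₁-out : Outside p q₂ r₁ r₂ q₁
            q₁-out = ≢-sym p≢q₁ , q₁≢q₂ , ≢-sym r₁≢q₁ , ≢-sym r₂≢q₁
            q₃-out : Outside p q₂ r₁ r₂ q₃
            q₃-out = ≢-sym p≢q₃ , ≢-sym q₂≢q₃ , ≢-sym r₁≢q₃ , ≢-sym r₂≢q₃
            r₃-out′ : Outside p q₂ r₁ r₂ r₃
            r₃-out′ = r₃≢p , r₃≢q₂ , r₃≢r₁ , r₃≢r₂
        in trans (sym (proj₂ triangle)) (trans (mono-M q₁ q₃ q₁-out q₃-out q₁≢q₃)
             (trans (sym (mono-M q₃ r₃ q₃-out r₃-out′ (≢-sym r₃≢q₃))) (star₃ r₃ r₃-out)))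

      q₂q₃-nonflat : h ≢ a → ∀ {r} → R r → r ≢ r₃ → ¬ Flat q₂ q₃ r r₃
      q₂q₃-nonflat h≢a r-out r≢r₃ (e₂ , _) = h≢a (sym (+₃-cancelʳ a h h (trans (+₃-comm a h)
        (trans (sym (cong₂ _+₃_ triangle≡h (mono _ r₃ r-out r₃-out r≢r₃)))
          (trans e₂ (cong₂ _+₃_ (star₂ _ r-out) (star₃ r₃ r₃-out)))))))

      p-agrees-with-q₁ : h ≢ a → ∀ {rᵢ rⱼ} → R rᵢ → R rⱼ → rᵢ ≢ rⱼ → rᵢ ≢ r₃ → rⱼ ≢ r₃ → χ p rᵢ ≡ χ p q₁
      p-agrees-with-q₁ h≢a {rᵢ} {rⱼ} (rᵢ≢p , _ , rᵢ≢q₂ , rᵢ≢q₃) rⱼ-out@(rⱼ≢p , rⱼ≢q₁ , rⱼ≢q₂ , rⱼ≢q₃)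
                       rᵢ≢rⱼ rᵢ≢r₃ rⱼ≢r₃ =
        let (p≢q₁ , p≢q₂ , p≢q₃ , q₁≢q₂ , q₁≢q₃ , q₂≢q₃) = distinct
            (r₃≢p , r₃≢q₁ , r₃≢q₂ , r₃≢q₃) = r₃-out
            (M , mono-M) = mono-outside (q₂≢q₃ , ≢-sym rⱼ≢q₂ , ≢-sym r₃≢q₂ , ≢-sym rⱼ≢q₃ , ≢-sym r₃≢q₃ , rⱼ≢r₃)
                             (q₂q₃-nonflat h≢a rⱼ-out rⱼ≢r₃)
            p-out : Outside q₂ q₃ rⱼ r₃ p
            p-out = p≢q₂ , p≢q₃ , ≢-sym rⱼ≢p , ≢-sym r₃≢p
            rᵢ-out : Outside q₂ q₃ rⱼ r₃ rᵢ
            rᵢ-out = rᵢ≢q₂ , rᵢ≢q₃ , rᵢ≢rⱼ , rᵢ≢r₃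
            q₁-out : Outside q₂ q₃ rⱼ r₃ q₁
            q₁-out = q₁≢q₂ , q₁≢q₃ , ≢-sym rⱼ≢q₁ , ≢-sym r₃≢q₁
        in trans (mono-M p rᵢ p-out rᵢ-out (≢-sym rᵢ≢p)) (sym (mono-M p q₁ p-out q₁-out p≢q₁))

      h≡a : h ≡ a
      h≡a = decidable-stable (h ≟ a) λ h≢a → split
        (trans (p-agrees-with-q₁ h≢a r₁-out r₂-out r₁≢r₂ (≢-sym r₃≢r₁) (≢-sym r₃≢r₂))
          (sym (p-agrees-with-q₁ h≢a r₂-out r₁-out (≢-sym r₁≢r₂) (≢-sym r₃≢r₂) (≢-sym r₃≢r₁))))

      clique : MonoOn (InQ p q₁) a
      clique = MonoOn-extend₂ mono (λ r r-out → trans (star₂ r r-out) h≡a)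
        (λ r r-out → trans (star₃ r r-out) h≡a) (trans triangle≡h h≡a)

    splitting-apex-clique : ∀ {p q₁ q₂ q₃} → NonFlatQuad p q₁ q₂ q₃ → Splits p (Outside p q₁ q₂ q₃) →
      UniformOn q₂ (Outside p q₁ q₂ q₃) → UniformOn q₃ (Outside p q₁ q₂ q₃) → AllButTwoMono
    splitting-apex-clique {p} {q₁} {q₂} {q₃} Q (r₁ , r₂ , r₁-out , r₂-out , split) uniform₂ uniform₃ =
      let (r₃ , r₃-out , r₃≢r₁ , r₃≢r₂) = pick-outside p q₁ q₂ q₃ r₁ r₂
          (p≢q₁ , _) = NonFlatQuad.distinct Q
      in p , q₁ , p≢q₁ , NonFlatQuad.colour Q ,
         SplittingApex.clique Q r₁-out r₂-out r₃-out r₃≢r₁ r₃≢r₂ split uniform₂ uniform₃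

    splitting-apex⇒clique : ∀ {p q₁ q₂ q₃} → NonFlatQuad p q₁ q₂ q₃ → Splits p (Outside p q₁ q₂ q₃) → AllButTwoMono
    splitting-apex⇒clique {p} {q₁} {q₂} {q₃} Q p-splits
      with uniform-or-split (outside? p q₁ q₂ q₃) q₁
         | uniform-or-split (outside? p q₁ q₂ q₃) q₂
         | uniform-or-split (outside? p q₁ q₂ q₃) q₃
    ... | inj₂ q₁-splits | inj₂ q₂-splits | _ =
      ⊥-elim (three-splitting-vertices-impossible Q p-splits q₁-splits q₂-splits)
    ... | inj₂ q₁-splits | inj₁ _ | inj₂ q₃-splits =
      ⊥-elim (three-splitting-vertices-impossible (NonFlatQuad-swap₃₄ Q)
        (Splits-⊆ Outside-swap₃₄ p-splits) (Splits-⊆ Outside-swap₃₄ q₁-splits) (Splits-⊆ Outside-swap₃₄ q₃-splits))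
    ... | inj₂ _ | inj₁ uniform₂ | inj₁ uniform₃ = splitting-apex-clique Q p-splits uniform₂ uniform₃
    ... | inj₁ _ | inj₂ q₂-splits | inj₂ q₃-splits =
      ⊥-elim (three-splitting-vertices-impossible (NonFlatQuad-swap₃₄ (NonFlatQuad-swap₂₃ Q))
        (Splits-⊆ to-perm p-splits) (Splits-⊆ to-perm q₂-splits) (Splits-⊆ to-perm q₃-splits))
      where
      to-perm : ∀ {r} → Outside p q₁ q₂ q₃ r → Outside p q₂ q₃ q₁ r
      to-perm = Outside-swap₃₄ ∘ Outside-swap₂₃
    ... | inj₁ uniform₁ | inj₂ _ | inj₁ uniform₃ =
      splitting-apex-clique (NonFlatQuad-swap₂₃ Q) (Splits-⊆ Outside-swap₂₃ p-splits)
        (UniformOn-⊆ Outside-swap₂₃ uniform₁) (UniformOn-⊆ Outside-swap₂₃ uniform₃)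
    ... | inj₁ uniform₁ | inj₁ uniform₂ | _ =
      splitting-apex-clique (NonFlatQuad-swap₂₃ (NonFlatQuad-swap₃₄ Q)) (Splits-⊆ to-perm p-splits)
        (UniformOn-⊆ from-perm uniform₁) (UniformOn-⊆ from-perm uniform₂)
      where
      to-perm : ∀ {r} → Outside p q₁ q₂ q₃ r → Outside p q₃ q₁ q₂ r
      to-perm = Outside-swap₂₃ ∘ Outside-swap₃₄
      from-perm : ∀ {r} → Outside p q₃ q₁ q₂ r → Outside p q₁ q₂ q₃ r
      from-perm = Outside-swap₃₄ ∘ Outside-swap₂₃

    module _ {t u s v : Fin n} (U : UniformQuad t u s v) where
      open UniformQuad U renaming (colour to a)

      -- χ t u +₃ a ≡ f t +₃ f u says that {t, u, r, r′} is flat for all r, r′ outside.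
      pair-defect⇒rest-mono : χ t u +₃ a ≢ f t +₃ f u → χ s v ≡ f s × f v ≡ f s
      pair-defect⇒rest-mono defect =
        let (t≢u , t≢s , t≢v , u≢s , u≢v , s≢v) = distinct
            (r₀≢t , r₀≢u , r₀≢s , r₀≢v) = r₀-out
            (r₁ , r₁-out , r₁≢r₀ , _) = pick-outside t u s v r₀ r₀
            (r₁≢t , r₁≢u , r₁≢s , r₁≢v) = r₁-out
            (r₂ , r₂-out , r₂≢r₀ , r₂≢r₁) = pick-outside t u s v r₀ r₁
            (r₂≢t , r₂≢u , r₂≢s , r₂≢v) = r₂-out
            ¬flat : ¬ Flat t u r₀ r₁
            ¬flat (e₂ , _) = defect (trans (cong (χ t u +₃_) (sym (mono r₀ r₁ r₀-out r₁-out (≢-sym r₁≢r₀))))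
                                      (trans e₂ (cong (f t +₃_) (uniform₂ r₁ r₀ r₁-out r₀-out))))
            (e , mono-e) = mono-outside (t≢u , ≢-sym r₀≢t , ≢-sym r₁≢t , ≢-sym r₀≢u , ≢-sym r₁≢u , ≢-sym r₁≢r₀) ¬flat
            s-out : Outside t u r₀ r₁ s
            s-out = ≢-sym t≢s , ≢-sym u≢s , ≢-sym r₀≢s , ≢-sym r₁≢s
            v-out : Outside t u r₀ r₁ v
            v-out = ≢-sym t≢v , ≢-sym u≢v , ≢-sym r₀≢v , ≢-sym r₁≢v
            r₂-out′ : Outside t u r₀ r₁ r₂
            r₂-out′ = r₂≢t , r₂≢u , r₂≢r₀ , r₂≢r₁
            fs≡e : f s ≡ e
            fs≡e = trans (uniform₃ r₀ r₂ r₀-out r₂-out) (mono-e s r₂ s-out r₂-out′ (≢-sym r₂≢s))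
            fv≡e : f v ≡ e
            fv≡e = trans (uniform₄ r₀ r₂ r₀-out r₂-out) (mono-e v r₂ v-out r₂-out′ (≢-sym r₂≢v))
        in trans (mono-e s v s-out v-out s≢v) (sym fs≡e) , trans fv≡e (sym fs≡e)

      -- Otherwise the monochromatic outside of {t, u, s, r₀} contains v and two more outside
      -- vertices, which forces f v ≡ a.
      flat-with-r₀ : f v ≢ a → Flat t u s r₀
      flat-with-r₀ fv≢a = decidable-stable (flat? t u s r₀) λ ¬flat →
        let (t≢u , t≢s , t≢v , u≢s , u≢v , s≢v) = distinct
            (r₀≢t , r₀≢u , r₀≢s , r₀≢v) = r₀-out
            (r₁ , r₁-out , r₁≢r₀ , _) = pick-outside t u s v r₀ r₀
            (r₁≢t , r₁≢u , r₁≢s , r₁≢v) = r₁-out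
            (r₂ , r₂-out , r₂≢r₀ , r₂≢r₁) = pick-outside t u s v r₀ r₁
            (r₂≢t , r₂≢u , r₂≢s , _) = r₂-out
            (M , mono-M) = mono-outside (t≢u , t≢s , ≢-sym r₀≢t , u≢s , ≢-sym r₀≢u , ≢-sym r₀≢s) ¬flat
            v-out : Outside t u s r₀ v
            v-out = ≢-sym t≢v , ≢-sym u≢v , ≢-sym s≢v , ≢-sym r₀≢v
            r₁-out′ : Outside t u s r₀ r₁
            r₁-out′ = r₁≢t , r₁≢u , r₁≢s , r₁≢r₀
            r₂-out′ : Outside t u s r₀ r₂
            r₂-out′ = r₂≢t , r₂≢u , r₂≢s , r₂≢r₀
        in fv≢a (trans (uniform₄ r₀ r₁ r₀-out r₁-out) (trans (mono-M v r₁ v-out r₁-out′ (≢-sym r₁≢v))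
             (trans (sym (mono-M r₁ r₂ r₁-out′ r₂-out′ (≢-sym r₂≢r₁))) (mono r₁ r₂ r₁-out r₂-out (≢-sym r₂≢r₁)))))

      off-colour-pair⇒defect : f s ≢ a → χ s v ≡ f s → f v ≡ f s → χ s v +₃ a ≢ f s +₃ f v
      off-colour-pair⇒defect fs≢a sv≡fs fv≡fs eq = fs≢a (sym (+₃-cancelʳ a (f s) (f s) (trans (+₃-comm a (f s))
        (trans (cong (_+₃ a) (sym sv≡fs)) (trans eq (cong (f s +₃_) fv≡fs))))))

    module _ {t u s v : Fin n} (U : UniformQuad t u s v) where
      open UniformQuad U renaming (colour to a)

      off-colour-pairs⇒flat : f s ≢ a → f t ≢ a → χ s v ≡ f s → f v ≡ f s → χ t u ≡ f t → f u ≡ f t → Flat t u s v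
      off-colour-pairs⇒flat fs≢a ft≢a sv≡fs fv≡fs tu≡ft fu≡ft =
        flat-of-sums (f s +₃ f s) (cong₂ _+₃_ (trans tu≡ft ft≡fs) sv≡fs)
          (cong₂ _+₃_ (proj₁ ts-us) (proj₂ tv-uv)) (cong₂ _+₃_ (proj₁ tv-uv) (proj₂ ts-us))
        where
        ts-us : χ t s ≡ f s × χ u s ≡ f s
        ts-us = flat-cross (flat-with-r₀ U (λ fv≡a → fs≢a (trans (sym fv≡fs) fv≡a))) tu≡ft refl refl fu≡ft
        tv-uv : χ t v ≡ f s × χ u v ≡ f s
        tv-uv = flat-cross (flat-with-r₀ (UniformQuad-swap₃₄ U) fs≢a) tu≡ft fv≡fs refl fu≡ft
        st-vt : χ s t ≡ f t × χ v t ≡ f t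
        st-vt = flat-cross (flat-with-r₀ (UniformQuad-flip U) (λ fu≡a → ft≢a (trans (sym fu≡ft) fu≡a)))
                  sv≡fs refl refl fv≡fs
        ft≡fs : f t ≡ f s
        ft≡fs = trans (sym (proj₁ st-vt)) (trans (χ-sym s t) (proj₁ ts-us))

      pair-defect⇒clique : χ t u +₃ a ≢ f t +₃ f u → AllButTwoMono
      pair-defect⇒clique defect with f s ≟ a | f t ≟ a
      ... | yes fs≡a | _ =
        let (sv≡fs , fv≡fs) = pair-defect⇒rest-mono U defect
        in t , u , proj₁ distinct , a , MonoOn-extend₂ mono (star-of U uniform₃ fs≡a)
             (star-of U uniform₄ (trans fv≡fs fs≡a)) (trans sv≡fs fs≡a)
      ... | no fs≢a | yes ft≡a =
        let (_ , _ , _ , _ , _ , s≢v) = distinct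
            (sv≡fs , fv≡fs) = pair-defect⇒rest-mono U defect
            U′ : UniformQuad s v t u
            U′ = UniformQuad-flip U
            (tu≡ft , fu≡ft) = pair-defect⇒rest-mono U′ (off-colour-pair⇒defect U fs≢a sv≡fs fv≡fs)
        in s , v , s≢v , a ,
           MonoOn-extend₂ (UniformQuad.mono U′) (star-of U′ (UniformQuad.uniform₃ U′) ft≡a)
             (star-of U′ (UniformQuad.uniform₄ U′) (trans fu≡ft ft≡a)) (trans tu≡ft ft≡a)
      ... | no fs≢a | no ft≢a =
        let (sv≡fs , fv≡fs) = pair-defect⇒rest-mono U defect
            (tu≡ft , fu≡ft) = pair-defect⇒rest-mono (UniformQuad-flip U) (off-colour-pair⇒defect U fs≢a sv≡fs fv≡fs)
        in ⊥-elim (nonflat (off-colour-pairs⇒flat fs≢a ft≢a sv≡fs fv≡fs tu≡ft fu≡ft))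

    module _ {w x y z : Fin n} (U : UniformQuad w x y z) where
      open UniformQuad U renaming (colour to a)

      uniform-quad⇒clique : AllButTwoMono
      uniform-quad⇒clique
        with χ w x +₃ a ℕ.≟ f w +₃ f x | χ y z +₃ a ℕ.≟ f y +₃ f z
           | χ w y +₃ a ℕ.≟ f w +₃ f y | χ x z +₃ a ℕ.≟ f x +₃ f z
           | χ w z +₃ a ℕ.≟ f w +₃ f z | χ x y +₃ a ℕ.≟ f x +₃ f y
      ... | no d | _ | _ | _ | _ | _ = pair-defect⇒clique U d
      ... | _ | no d | _ | _ | _ | _ = pair-defect⇒clique (UniformQuad-flip U) d
      ... | _ | _ | no d | _ | _ | _ = pair-defect⇒clique (UniformQuad-swap₂₃ U) d
      ... | _ | _ | _ | no d | _ | _ = pair-defect⇒clique (UniformQuad-flip (UniformQuad-swap₂₃ U)) d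
      ... | _ | _ | _ | _ | no d | _ = pair-defect⇒clique (UniformQuad-swap₂₃ (UniformQuad-swap₃₄ U)) d
      ... | _ | _ | _ | _ | _ | no d =
        pair-defect⇒clique (UniformQuad-flip (UniformQuad-swap₂₃ (UniformQuad-swap₃₄ U))) d
      ... | yes wx | yes yz | yes wy | yes xz | yes wz | yes xy = ⊥-elim (nonflat
        (flat-of-potential {fw = f w} {f x} {f y} {f z} a
          (solve w x wx) (solve w y wy) (solve w z wz) (solve x y xy) (solve x z xz) (solve y z yz)))
        where
        solve : ∀ p q → χ p q +₃ a ≡ f p +₃ f q → χ p q ≡ potential (f p) (f q) a
        solve p q = potential-unique (χ p q) a (f p) (f q)

    nonflat-quad⇒clique : ∀ {w x y z} → NonFlatQuad w x y z → AllButTwoMono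
    nonflat-quad⇒clique {w} {x} {y} {z} Q
      with uniform-or-split (outside? w x y z) w | uniform-or-split (outside? w x y z) x
         | uniform-or-split (outside? w x y z) y | uniform-or-split (outside? w x y z) z
    ... | inj₂ w-splits | _ | _ | _ = splitting-apex⇒clique Q w-splits
    ... | inj₁ _ | inj₂ x-splits | _ | _ =
      splitting-apex⇒clique (NonFlatQuad-swap₁₂ Q) (Splits-⊆ Outside-swap₁₂ x-splits)
    ... | inj₁ _ | inj₁ _ | inj₂ y-splits | _ =
      splitting-apex⇒clique (NonFlatQuad-swap₁₂ (NonFlatQuad-swap₂₃ Q))
        (Splits-⊆ (Outside-swap₁₂ ∘ Outside-swap₂₃) y-splits)
    ... | inj₁ _ | inj₁ _ | inj₁ _ | inj₂ z-splits =
      splitting-apex⇒clique (NonFlatQuad-swap₁₂ (NonFlatQuad-swap₂₃ (NonFlatQuad-swap₃₄ Q)))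
        (Splits-⊆ (Outside-swap₁₂ ∘ Outside-swap₂₃ ∘ Outside-swap₃₄) z-splits)
    ... | inj₁ uniform₁ | inj₁ uniform₂ | inj₁ uniform₃ | inj₁ uniform₄ =
      let (r₀ , r₀-out) = outside-vertex w x y z
      in uniform-quad⇒clique (record
           { quad = Q ; r₀ = r₀ ; r₀-out = r₀-out
           ; uniform₁ = uniform₁ ; uniform₂ = uniform₂ ; uniform₃ = uniform₃ ; uniform₄ = uniform₄ })

    alternating⇒clique : ∀ C → Alternating χ C → AllButTwoMono
    alternating⇒clique C@(cyc w x y z w≢x w≢y w≢z x≢y x≢z y≢z) alternating =
      nonflat-quad⇒clique (nonflat-quad (w≢x , w≢y , w≢z , x≢y , x≢z , y≢z) (alternating⇒¬flat C alternating))

    -- The three forms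

    Form2-shape : Fin n → Fin n → Colour → Colour → Colour → Colour → Colour → Set
    Form2-shape u v a b c fu fv =
      (fu ≡ b × fv ≡ b × χ u v ≡ b) ⊎ (fu ≡ b × fv ≡ b × χ u v ≡ a) ⊎ (fu ≡ b × fv ≡ c × χ u v ≡ b)

    form2 : ∀ {u v a b c fu fv} → u ≢ v → a ≢ b → a ≢ c → b ≢ c → MonoOn (InQ u v) a →
      MonoStar u (InQ u v) fu → MonoStar v (InQ u v) fv → Form2-shape u v a b c fu fv → Form2 χ
    form2 {u} {v} {a} {b} {c} {fu} {fv} u≢v a≢b a≢c b≢c mono star-u star-v shape =
      u , v , a , b , c , u≢v , a≢b , a≢c , b≢c , mono ,
      MonoStar⇒UniformOn star-u , MonoStar⇒UniformOn star-v , from-shape shape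
      where
      stars : ∀ {b′ c′} → fu ≡ b′ → fv ≡ c′ → ∀ p → InQ u v p → χ u p ≡ b′ × χ v p ≡ c′
      stars fu≡b′ fv≡c′ p p∈ = trans (star-u p p∈) fu≡b′ , trans (star-v p p∈) fv≡c′
      from-shape : Form2-shape u v a b c fu fv →
        ((∀ p → InQ u v p → χ u p ≡ b × χ v p ≡ b) × χ u v ≡ b) ⊎
        ((∀ p → InQ u v p → χ u p ≡ b × χ v p ≡ b) × χ u v ≡ a) ⊎
        ((∀ p → InQ u v p → χ u p ≡ b × χ v p ≡ c) × χ u v ≡ b)
      from-shape (inj₁ (fu≡b , fv≡b , uv≡b)) = inj₁ (stars fu≡b fv≡b , uv≡b)
      from-shape (inj₂ (inj₁ (fu≡b , fv≡b , uv≡a))) = inj₂ (inj₁ (stars fu≡b fv≡b , uv≡a))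
      from-shape (inj₂ (inj₂ (fu≡b , fv≡c , uv≡b))) = inj₂ (inj₂ (stars fu≡b fv≡c , uv≡b))

    form3 : ∀ {x y z d} → x ≢ y → x ≢ z → y ≢ z →
      (∀ p q → p ≢ x → p ≢ y → p ≢ z → p ≢ q → χ p q ≡ d) → Form3 χ
    form3 {x} {y} {z} {d} x≢y x≢z y≢z off-triangle = x , y , z , x≢y , x≢z , y≢z , d , edges
      where
      in-triangle? : ∀ p → (p ≡ x ⊎ p ≡ y ⊎ p ≡ z) ⊎ (p ≢ x × p ≢ y × p ≢ z)
      in-triangle? p with p ≟ x | p ≟ y | p ≟ z
      ... | yes p≡x | _ | _ = inj₁ (inj₁ p≡x)
      ... | no _ | yes p≡y | _ = inj₁ (inj₂ (inj₁ p≡y))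
      ... | no _ | no _ | yes p≡z = inj₁ (inj₂ (inj₂ p≡z))
      ... | no p≢x | no p≢y | no p≢z = inj₂ (p≢x , p≢y , p≢z)
      edges : ∀ p q → p ≢ q → ¬ InTri x y z p q → χ p q ≡ d
      edges p q p≢q not-in with in-triangle? p | in-triangle? q
      ... | inj₂ (p≢x , p≢y , p≢z) | _ = off-triangle p q p≢x p≢y p≢z p≢q
      ... | inj₁ _ | inj₂ (q≢x , q≢y , q≢z) = trans (χ-sym p q) (off-triangle q p q≢x q≢y q≢z (≢-sym p≢q))
      ... | inj₁ p∈ | inj₁ q∈ = ⊥-elim (not-in (p∈ , q∈))

    module TwoStars {u v : Fin n} {a fu fv : Colour} (mono : MonoOn (InQ u v) a)
      (star-u : MonoStar u (InQ u v) fu) (star-v : MonoStar v (InQ u v) fv) (uv-flat : χ u v +₃ a ≡ fu +₃ fv) where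

      F : Fin n → Colour
      F p with p ≟ u | p ≟ v
      ... | yes _ | _ = fu
      ... | no _ | yes _ = fv
      ... | no _ | no _ = a

      F-view : ∀ p → (p ≡ u × F p ≡ fu) ⊎ (p ≡ v × F p ≡ fv) ⊎ (InQ u v p × F p ≡ a)
      F-view p with p ≟ u | p ≟ v
      ... | yes p≡u | _ = inj₁ (p≡u , refl)
      ... | no _ | yes p≡v = inj₂ (inj₁ (p≡v , refl))
      ... | no p≢u | no p≢v = inj₂ (inj₂ ((p≢u , p≢v) , refl))

      uv≡potential : χ u v ≡ potential fu fv a
      uv≡potential = potential-unique (χ u v) a fu fv uv-flat

      star≡potential : ∀ {x p c} → χ x p ≡ c → χ x p ≡ potential c a a
      star≡potential {c = c} xp≡c = trans xp≡c (sym (potential-idʳ c a))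

      via-F : ∀ {p q b c} → F p ≡ b → F q ≡ c → χ p q ≡ potential b c a → χ p q ≡ potential (F p) (F q) a
      via-F Fp Fq pq≡ = trans pq≡ (cong₂ (λ b c → potential b c a) (sym Fp) (sym Fq))

      potential-form : ∀ p q → p ≢ q → χ p q ≡ potential (F p) (F q) a
      potential-form p q p≢q with F-view p | F-view q
      ... | inj₁ (refl , _) | inj₁ (refl , _) = ⊥-elim (p≢q refl)
      ... | inj₁ (refl , Fp) | inj₂ (inj₁ (refl , Fq)) = via-F Fp Fq uv≡potential
      ... | inj₁ (refl , Fp) | inj₂ (inj₂ (q∈ , Fq)) = via-F Fp Fq (star≡potential (star-u q q∈))
      ... | inj₂ (inj₁ (refl , Fp)) | inj₁ (refl , Fq) =
        via-F Fp Fq (trans (χ-sym v u) (trans uv≡potential (potential-comm fu fv a)))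
      ... | inj₂ (inj₁ (refl , _)) | inj₂ (inj₁ (refl , _)) = ⊥-elim (p≢q refl)
      ... | inj₂ (inj₁ (refl , Fp)) | inj₂ (inj₂ (q∈ , Fq)) = via-F Fp Fq (star≡potential (star-v q q∈))
      ... | inj₂ (inj₂ (p∈ , Fp)) | inj₁ (refl , Fq) =
        via-F Fp Fq (trans (χ-sym p u) (trans (star≡potential (star-u p p∈)) (potential-comm fu a a)))
      ... | inj₂ (inj₂ (p∈ , Fp)) | inj₂ (inj₁ (refl , Fq)) =
        via-F Fp Fq (trans (χ-sym p v) (trans (star≡potential (star-v p p∈)) (potential-comm fv a a)))
      ... | inj₂ (inj₂ (p∈ , Fp)) | inj₂ (inj₂ (q∈ , Fq)) = via-F Fp Fq (star≡potential (mono p q p∈ q∈ p≢q))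

    module SplittingEndpoint {u v : Fin n} (u≢v : u ≢ v) {a : Colour} (mono : MonoOn (InQ u v) a) where

      v-forced : ∀ {s s₁ s₂} → InQ u v s → InQ u v s₁ → InQ u v s₂ → s₁ ≢ s → s₂ ≢ s →
        χ u s₁ ≢ χ u s₂ → χ v s ≡ a
      v-forced {s} {s₁} {s₂} s∈@(s≢u , s≢v) s₁∈@(s₁≢u , s₁≢v) s₂∈@(s₂≢u , s₂≢v) s₁≢s s₂≢s split
        with s₃ , s₃≢u ∷ s₃≢v ∷ s₃≢s ∷ s₃≢s₁ ∷ s₃≢s₂ ∷ [] ← pick (u ∷ v ∷ s ∷ s₁ ∷ s₂ ∷ [])
        with s₄ , s₄≢u ∷ s₄≢v ∷ s₄≢s ∷ s₄≢s₁ ∷ s₄≢s₂ ∷ s₄≢s₃ ∷ [] ← pick (u ∷ v ∷ s ∷ s₁ ∷ s₂ ∷ s₃ ∷ [])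
        = let s₁≢s₂ : s₁ ≢ s₂
              s₁≢s₂ = split ∘ cong (χ u)
              s₃∈ : InQ u v s₃
              s₃∈ = s₃≢u , s₃≢v
              (M , mono-M) = split-triangle-outside
                (≢-sym s₁≢u , ≢-sym s₂≢u , ≢-sym s₃≢u , s₁≢s₂ , ≢-sym s₃≢s₁ , ≢-sym s₃≢s₂)
                (mono s₁ s₂ s₁∈ s₂∈ s₁≢s₂) (mono s₁ s₃ s₁∈ s₃∈ (≢-sym s₃≢s₁)) (mono s₂ s₃ s₂∈ s₃∈ (≢-sym s₃≢s₂)) split
              v-out : Outside u s₁ s₂ s₃ v
              v-out = ≢-sym u≢v , ≢-sym s₁≢v , ≢-sym s₂≢v , ≢-sym s₃≢v
              s-out : Outside u s₁ s₂ s₃ s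
              s-out = s≢u , ≢-sym s₁≢s , ≢-sym s₂≢s , ≢-sym s₃≢s
              s₄-out : Outside u s₁ s₂ s₃ s₄
              s₄-out = s₄≢u , s₄≢s₁ , s₄≢s₂ , s₄≢s₃
          in trans (mono-M v s v-out s-out (≢-sym s≢v))
               (trans (sym (mono-M s s₄ s-out s₄-out (≢-sym s₄≢s))) (mono s s₄ s∈ (s₄≢u , s₄≢v) (≢-sym s₄≢s)))

      module ExceptionalVertex {s₁ s₂} (s₁∈ : InQ u v s₁) (s₂∈ : InQ u v s₂) (split : χ u s₁ ≢ χ u s₂)
        {t} (t∈ : InQ u v t) (vt≢a : χ v t ≢ a) {b} (b∈ : InQ u v b) (b≢t : b ≢ t) where

        u-uniform-off-t : ∀ {p q} → InQ u v p → InQ u v q → p ≢ t → q ≢ t → χ u p ≡ χ u q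
        u-uniform-off-t {p} {q} p∈ q∈ p≢t q≢t =
          decidable-stable (χ u p ≟ χ u q) λ split′ → vt≢a (v-forced t∈ p∈ q∈ p≢t q≢t split′)

        β : Colour
        β = χ u b

        u-star : ∀ {p} → InQ u v p → p ≢ t → χ u p ≡ β
        u-star p∈ p≢t = u-uniform-off-t p∈ b∈ p≢t b≢t

        ut≢β : χ u t ≢ β
        ut≢β ut≡β = split (trans (u-star′ s₁∈) (sym (u-star′ s₂∈)))
          where
          u-star′ : ∀ {p} → InQ u v p → χ u p ≡ β
          u-star′ {p} p∈ with p ≟ t
          ... | yes refl = ut≡β
          ... | no p≢t = u-star p∈ p≢t

        v-star-off-t : ∀ {q} → InQ u v q → q ≢ t → χ v q ≡ a
        v-star-off-t {q} q∈ q≢t with b′ , b′≢u ∷ b′≢v ∷ b′≢t ∷ b′≢q ∷ [] ← pick (u ∷ v ∷ t ∷ q ∷ []) =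
          v-forced q∈ t∈ (b′≢u , b′≢v) (≢-sym q≢t) b′≢q (λ ut≡ub′ → ut≢β (trans ut≡ub′ (u-star (b′≢u , b′≢v) b′≢t)))

        β≡a : β ≡ a
        β≡a
          with x₂ , x₂≢u ∷ x₂≢v ∷ x₂≢t ∷ x₂≢b ∷ [] ← pick (u ∷ v ∷ t ∷ b ∷ [])
          with x₃ , x₃≢u ∷ x₃≢v ∷ x₃≢t ∷ x₃≢b ∷ x₃≢x₂ ∷ [] ← pick (u ∷ v ∷ t ∷ b ∷ x₂ ∷ [])
          with x₄ , x₄≢u ∷ x₄≢v ∷ x₄≢t ∷ x₄≢b ∷ x₄≢x₂ ∷ x₄≢x₃ ∷ [] ← pick (u ∷ v ∷ t ∷ b ∷ x₂ ∷ x₃ ∷ [])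
          = let (t≢u , t≢v) = t∈
                (b≢u , b≢v) = b∈
                x₂∈ : InQ u v x₂
                x₂∈ = x₂≢u , x₂≢v
                ¬flat : ¬ Flat t v b x₂
                ¬flat (e₂ , _) = vt≢a (trans (χ-sym v t) (+₃-cancelʳ (χ t v) a a
                  (trans (cong (χ t v +₃_) (sym (mono b x₂ b∈ x₂∈ (≢-sym x₂≢b))))
                    (trans e₂ (cong₂ _+₃_ (mono t b t∈ b∈ (≢-sym b≢t)) (v-star-off-t x₂∈ x₂≢t))))))
                (M , mono-M) = mono-outside (t≢v , ≢-sym b≢t , ≢-sym x₂≢t , ≢-sym b≢v , ≢-sym x₂≢v , ≢-sym x₂≢b) ¬flat
                u-out : Outside t v b x₂ u
                u-out = ≢-sym t≢u , u≢v , ≢-sym b≢u , ≢-sym x₂≢u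
                x₃-out : Outside t v b x₂ x₃
                x₃-out = x₃≢t , x₃≢v , x₃≢b , x₃≢x₂
                x₄-out : Outside t v b x₂ x₄
                x₄-out = x₄≢t , x₄≢v , x₄≢b , x₄≢x₂
            in trans (sym (u-star (x₃≢u , x₃≢v) x₃≢t)) (trans (mono-M u x₃ u-out x₃-out (≢-sym x₃≢u))
                 (trans (sym (mono-M x₃ x₄ x₃-out x₄-out (≢-sym x₄≢x₃)))
                   (mono x₃ x₄ (x₃≢u , x₃≢v) (x₄≢u , x₄≢v) (≢-sym x₄≢x₃))))

        triangle-form : Form3 χ
        triangle-form = form3 u≢v (≢-sym (proj₁ t∈)) (≢-sym (proj₂ t∈)) off-triangle
          where
          off-triangle : ∀ p q → p ≢ u → p ≢ v → p ≢ t → p ≢ q → χ p q ≡ a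
          off-triangle p q p≢u p≢v p≢t p≢q with q ≟ u | q ≟ v
          ... | yes refl | _ = trans (χ-sym p u) (trans (u-star (p≢u , p≢v) p≢t) β≡a)
          ... | no _ | yes refl = trans (χ-sym p v) (v-star-off-t (p≢u , p≢v) p≢t)
          ... | no q≢u | no q≢v = mono p q (p≢u , p≢v) (q≢u , q≢v) p≢q

      splitting-endpoint⇒form : Splits u (InQ u v) → Form1 χ ⊎ Form2 χ ⊎ Form3 χ
      splitting-endpoint⇒form (s₁ , s₂ , s₁∈ , s₂∈ , split) with star-or-exception (InQ? u v) v a
      ... | inj₁ v-star = inj₁ (u , a , MonoOn-extend₁ mono v-star , s₁ , s₂ , proj₁ s₁∈ , proj₁ s₂∈ , split)
      ... | inj₂ (t , t∈ , vt≢a) with b , b≢u ∷ b≢v ∷ b≢t ∷ [] ← pick (u ∷ v ∷ t ∷ []) =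
        inj₂ (inj₂ (ExceptionalVertex.triangle-form s₁∈ s₂∈ split t∈ vt≢a (b≢u , b≢v) b≢t))

    module _ (C₀ : FourCycle n) (alternating₀ : Alternating χ C₀) where

      ¬uv-flat : ∀ {u v a fu fv} → MonoOn (InQ u v) a → MonoStar u (InQ u v) fu → MonoStar v (InQ u v) fv →
        χ u v +₃ a ≢ fu +₃ fv
      ¬uv-flat {a = a} mono star-u star-v uv-flat =
        potential⇒¬alternating F a (TwoStars.potential-form mono star-u star-v uv-flat) C₀ alternating₀
        where
        F : Fin n → Colour
        F = TwoStars.F mono star-u star-v uv-flat

      equal-stars⇒form2 : ∀ {u v a b} → u ≢ v → b ≢ a → MonoOn (InQ u v) a →
        MonoStar u (InQ u v) b → MonoStar v (InQ u v) b → Form2 χ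
      equal-stars⇒form2 {u} {v} {a} {b} u≢v b≢a mono star-u star-v with χ u v ≟ b | χ u v ≟ a
      ... | yes uv≡b | _ =
        let (c , a≢c , b≢c) = third-colour a b (≢-sym b≢a)
        in form2 u≢v (≢-sym b≢a) a≢c b≢c mono star-u star-v (inj₁ (refl , refl , uv≡b))
      ... | no _ | yes uv≡a =
        let (c , a≢c , b≢c) = third-colour a b (≢-sym b≢a)
        in form2 u≢v (≢-sym b≢a) a≢c b≢c mono star-u star-v (inj₂ (inj₁ (refl , refl , uv≡a)))
      ... | no uv≢b | no uv≢a = ⊥-elim (¬uv-flat mono star-u star-v (distinct-sum (χ u v) a b uv≢a uv≢b (≢-sym b≢a)))

      distinct-stars⇒form2 : ∀ {u v a fu fv} → u ≢ v → fu ≢ a → fv ≢ a → fu ≢ fv → MonoOn (InQ u v) a →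
        MonoStar u (InQ u v) fu → MonoStar v (InQ u v) fv → Form2 χ
      distinct-stars⇒form2 {u} {v} {a} {fu} {fv} u≢v fu≢a fv≢a fu≢fv mono star-u star-v with χ u v ≟ fu | χ u v ≟ fv
      ... | yes uv≡fu | _ =
        form2 u≢v (≢-sym fu≢a) (≢-sym fv≢a) fu≢fv mono star-u star-v (inj₂ (inj₂ (refl , refl , uv≡fu)))
      ... | no _ | yes uv≡fv =
        form2 (≢-sym u≢v) (≢-sym fv≢a) (≢-sym fu≢a) (≢-sym fu≢fv) (MonoOn-⊆ swap mono)
          (λ p → star-v p ∘ swap) (λ p → star-u p ∘ swap) (inj₂ (inj₂ (refl , refl , trans (χ-sym v u) uv≡fv)))
      ... | no uv≢fu | no uv≢fv =
        ⊥-elim (¬uv-flat mono star-u star-v (trans (cong (_+₃ a) uv≡a) (sym (distinct-sum fu fv a fu≢fv fu≢a fv≢a))))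
        where
        uv≡a : χ u v ≡ a
        uv≡a = only-three-colours a fu fv (χ u v) (≢-sym fu≢a) (≢-sym fv≢a) fu≢fv uv≢fu uv≢fv

      two-stars⇒form : ∀ {u v a fu fv} → u ≢ v → MonoOn (InQ u v) a →
        MonoStar u (InQ u v) fu → MonoStar v (InQ u v) fv → Form1 χ ⊎ Form2 χ ⊎ Form3 χ
      two-stars⇒form {u} {v} {a} {fu} {fv} u≢v mono star-u star-v
        with s₀ , s₀≢u ∷ s₀≢v ∷ [] ← pick (u ∷ v ∷ [])
        with fu ≟ a | fv ≟ a | fu ≟ fv
      ... | yes refl | _ | _ = inj₁ (v , fu , MonoOn-extend₁ (MonoOn-⊆ swap mono) (λ p → star-u p ∘ swap) ,
                                     u , s₀ , u≢v , s₀≢v , λ vu≡vs₀ → ¬uv-flat mono star-u star-v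
          (trans (cong (_+₃ fu) (trans (χ-sym u v) (trans vu≡vs₀ (star-v s₀ (s₀≢u , s₀≢v))))) (+₃-comm fv fu)))
      ... | no _ | yes refl | _ = inj₁ (u , fv , MonoOn-extend₁ mono star-v , v , s₀ , ≢-sym u≢v , s₀≢u ,
          λ uv≡us₀ → ¬uv-flat mono star-u star-v (cong (_+₃ fv) (trans uv≡us₀ (star-u s₀ (s₀≢u , s₀≢v)))))
      ... | no fu≢a | no _ | yes refl = inj₂ (inj₁ (equal-stars⇒form2 u≢v fu≢a mono star-u star-v))
      ... | no fu≢a | no fv≢a | no fu≢fv = inj₂ (inj₁ (distinct-stars⇒form2 u≢v fu≢a fv≢a fu≢fv mono star-u star-v))

      clique⇒form : AllButTwoMono → Form1 χ ⊎ Form2 χ ⊎ Form3 χ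
      clique⇒form (u , v , u≢v , a , mono) with uniform-or-split (InQ? u v) u | uniform-or-split (InQ? u v) v
      ... | inj₂ u-splits | _ = SplittingEndpoint.splitting-endpoint⇒form u≢v mono u-splits
      ... | inj₁ _ | inj₂ v-splits =
        SplittingEndpoint.splitting-endpoint⇒form (≢-sym u≢v) (MonoOn-⊆ swap mono) (Splits-⊆ swap v-splits)
      ... | inj₁ uniform-u | inj₁ uniform-v with s₀ , s₀≢u ∷ s₀≢v ∷ [] ← pick (u ∷ v ∷ []) =
        two-stars⇒form u≢v mono
          (UniformOn⇒MonoStar uniform-u (s₀≢u , s₀≢v)) (UniformOn⇒MonoStar uniform-v (s₀≢u , s₀≢v))

-- Two disjoint alternating 4-cycles are already excluded by the last hypothesis, which makes the
-- complement of an alternating 4-cycle monochromatic.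
lemma4p11 : (n : ℕ) → 7 ≤ n → (χ : Colouring n) → Symmetric χ →
    Σ (FourCycle n) (Alternating χ) →
    ¬ (Σ (FourCycle n) λ C → Σ (FourCycle n) λ D → Alternating χ C × Alternating χ D × VertexDisjoint C D) →
    (∀ C → Alternating χ C → MonoOutside χ C) →
    Form1 χ ⊎ Form2 χ ⊎ Form3 χ
lemma4p11 n n≥7 χ χ-sym (C₀ , alternating₀) _ alternating⇒mono =
  clique⇒form χ χ-sym n≥7 alternating⇒mono C₀ alternating₀
    (alternating⇒clique χ χ-sym n≥7 alternating⇒mono C₀ alternating₀)
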